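{- For positive integers $n,m$, the rectangle $(n^m)$ has exactly $mn$ distinct partitions reachable from it in LCTR by a sequence of one or more moves. Any partition of $N$ which is not a rectangle has fewer than $N$ distinct partitions reachable from it.
   Context: $(n^m)$ denotes the partition with $m$ parts equal to $n$; a rectangle is a partition of this form. LCTR moves: from nonempty $\lambda=(\lambda_1,\dots,\lambda_k)$ one may move to $T(\lambda)=(\lambda_2,\dots,\lambda_k)$ or $L(\lambda)=(\lambda_1-1,\dots,\lambda_k-1)$ (nonpositive entries omitted); the empty partition has no moves. Reachable partitions include the empty partition but not $\lambda$ itself. -}

module Defs where

open import Data.Nat using (ℕ; zero; suc; _∸_; _≥_; _<_; _*_; _>_)
open import Data.List using (List; []; _∷_; map; filter; replicate; length)
open import Data.Nat.ListAction using (sum)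
open import Data.List.Relation.Unary.All using (All)
open import Data.List.Relation.Unary.Linked using (Linked)
open import Data.List.Relation.Unary.Unique.Propositional using (Unique)
open import Data.List.Membership.Propositional using (_∈_)
open import Data.Product using (Σ; ∃; _×_)
open import Function.Bundles using (_⇔_)
open import Data.Nat.Properties using (_>?_)
open import Relation.Binary.PropositionalEquality using (_≡_)

IsPartition : List ℕ → Set
IsPartition λs = All (λ x → x > 0) λs × Linked _≥_ λs

∣_∣ₚ : List ℕ → ℕ
∣ λs ∣ₚ = sum λs

rect : ℕ → ℕ → List ℕ
rect n m = replicate m n

IsRectangle : List ℕ → Set
IsRectangle λs = ∃ λ n → ∃ λ m → λs ≡ rect n m

T : List ℕ → List ℕ
T [] = []
T (_ ∷ xs) = xs

L : List ℕ → List ℕ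
L xs = filter (_>? 0) (map (λ x → x ∸ 1) xs)

data Move : List ℕ → List ℕ → Set where
  moveT : ∀ x xs → Move (x ∷ xs) (T (x ∷ xs))
  moveL : ∀ x xs → Move (x ∷ xs) (L (x ∷ xs))

data Reach : List ℕ → List ℕ → Set where
  one  : ∀ {a b} → Move a b → Reach a b
  step : ∀ {a b c} → Move a b → Reach b c → Reach a c

NumReachable : List ℕ → ℕ → Set
NumReachable λs k =
  Σ (List (List ℕ)) λ xs → Unique xs × (∀ μ → (μ ∈ xs) ⇔ Reach λs μ) × length xs ≡ k

-- Index the cells of the Young diagram of λ by (i , j) with j < λᵢ, and attach to
-- the cell the partition Lʲ (Tⁱ λ) of the cells weakly south-east of it.  The
-- partitions reachable from λ by zero or more moves are exactly these |λ|
-- subdiagrams together with [], and λ itself (the subdiagram of the corner) is not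
-- reachable by a nonempty sequence of moves because every move shrinks the size.
-- Replacing λ by [] therefore lists the reachable partitions with |λ| entries.  For
-- a rectangle the subdiagrams are pairwise distinct rectangles.  Otherwise either
-- the first two rows have equal length and we recurse on the tail, or λ₁ > λ₂, and
-- then the single box (1) occurs twice: at the end of the first row and at the end
-- of the last row.

module Submission where

open import Defs
open import Data.Nat using (ℕ; zero; suc; _+_; _*_; _∸_; _≤_; _<_; _>_; _≥_; _≟_; z≤n; s≤s; _<?_; _>?_)
open import Data.Nat.Properties
  using (≤-refl; ≤-trans; ≤-reflexive; <-trans; <-≤-trans; <-irrefl; <⇒≢; ≤⇒≯; ≮⇒≥; 1+n≰n; n<1+n; n≤1+n;
         m≤n⇒m≤1+n; m≤n⇒m<n∨m≡n; m<n+m; +-mono-≤; +-monoʳ-≤; ∸-monoˡ-≤; suc-injective)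
open import Data.Nat.GeneralisedArithmetic using (iterate)
open import Data.Nat.ListAction using (sum)
open import Data.List as List using (List; []; _∷_; [_]; _++_; length; map; drop; replicate; applyDownFrom; deduplicate)
open import Data.List.Properties
  using (length-++; length-iterate; length-replicate; length-filter; length-map; length-deduplicate;
         filter-none; filter-notAll; ∷-injectiveˡ; ≡-dec)
open import Data.List.Relation.Unary.All as All using (All; []; _∷_)
open import Data.List.Relation.Unary.All.Properties
  using (all-filter; replicate⁺) renaming (map⁺ to All-map⁺; filter⁺ to All-filter⁺)
open import Data.List.Relation.Unary.Any as Any using (here; there)
open import Data.List.Relation.Unary.AllPairs using (_∷_)
open import Data.List.Relation.Unary.Linked as Linked using (Linked; _∷_)
open import Data.List.Relation.Unary.Linked.Properties
  using (Linked⇒All) renaming (map⁺ to Linked-map⁺; filter⁺ to Linked-filter⁺)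
open import Data.List.Relation.Unary.Unique.Propositional using (Unique; [])
open import Data.List.Relation.Unary.Unique.Propositional.Properties using (++⁺; drop⁺; applyDownFrom⁺₁)
open import Data.List.Relation.Unary.Unique.DecPropositional.Properties using (deduplicate-!)
open import Data.List.Relation.Binary.Disjoint.Propositional using (Disjoint)
open import Data.List.Membership.Propositional using (_∈_; _∉_)
open import Data.List.Membership.Propositional.Properties
  using (∈-++⁺ˡ; ∈-++⁺ʳ; ∈-++⁻; ∈-applyDownFrom⁻; ∈-deduplicate⁺; ∈-deduplicate⁻)
open import Data.List.Membership.DecPropositional using (_∈?_)
open import Data.Product using (∃; ∃-syntax; _×_; _,_; proj₁)
open import Data.Sum using (inj₁; inj₂)
open import Data.Empty using (⊥-elim)
open import Function using (_∘_; flip; _⇔_; mk⇔; Equivalence)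
open import Relation.Binary.Definitions using (DecidableEquality; Transitive)
open import Relation.Binary.Construct.Closure.ReflexiveTransitive using (Star; ε; _◅_)
open import Relation.Nullary using (¬_; ¬?; yes; no)
open import Relation.Binary.PropositionalEquality using (_≡_; _≢_; refl; sym; trans; cong; cong₂; subst; subst₂)

module _ {A : Set} (f : A → A) where

  iterate-sucʳ : ∀ x j → iterate f x (suc j) ≡ f (iterate f x j)
  iterate-sucʳ x zero    = refl
  iterate-sucʳ x (suc j) = iterate-sucʳ (f x) j

  ∈-iterate⁺ : ∀ x {j k} → j < k → iterate f x j ∈ List.iterate f x k
  ∈-iterate⁺ x {zero}  (s≤s _)   = here refl
  ∈-iterate⁺ x {suc j} (s≤s j<k) = there (∈-iterate⁺ (f x) j<k)

  ∈-iterate⁻ : ∀ x {k z} → z ∈ List.iterate f x k → ∃[ j ] j < k × z ≡ iterate f x j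
  ∈-iterate⁻ x {suc k} (here z≡x) = 0 , s≤s z≤n , z≡x
  ∈-iterate⁻ x {suc k} (there z∈) with j , j<k , z≡ ← ∈-iterate⁻ (f x) z∈ = suc j , s≤s j<k , z≡

≥-trans : Transitive _≥_
≥-trans = flip ≤-trans

L-preserves-IsPartition : ∀ {xs} → IsPartition xs → IsPartition (L xs)
L-preserves-IsPartition {xs} (_ , sorted) =
  all-filter (_>? 0) (map (λ x → x ∸ 1) xs) ,
  Linked-filter⁺ (_>? 0) ≥-trans (Linked-map⁺ (Linked.map (∸-monoˡ-≤ 1) sorted))

IsPartition-tail : ∀ {x xs} → IsPartition (x ∷ xs) → IsPartition xs
IsPartition-tail (_ ∷ pos , sorted) = pos , Linked.tail sorted

head-dominates : ∀ {x xs} → IsPartition (x ∷ xs) → All (_≤ x) xs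
head-dominates (_ , sorted) with _ ∷ x≥xs ← Linked⇒All ≥-trans ≤-refl sorted = x≥xs

L-bounded : ∀ {b xs} → All (_≤ suc b) xs → All (_≤ b) (L xs)
L-bounded xs≤ = All-filter⁺ (_>? 0) (All-map⁺ (All.map (∸-monoˡ-≤ 1) xs≤))

L-vanishes : ∀ {xs} → All (_≤ 1) xs → L xs ≡ []
L-vanishes xs≤ = filter-none (_>? 0) (All-map⁺ (All.map (≤⇒≯ ∘ ∸-monoˡ-≤ 1) xs≤))

iterate-L-vanishes : ∀ j {xs} → All (_≤ suc j) xs → iterate L xs (suc j) ≡ []
iterate-L-vanishes zero    xs≤ = L-vanishes xs≤
iterate-L-vanishes (suc j) xs≤ = iterate-L-vanishes j (L-bounded xs≤)

iterate-L-beyond-head : ∀ {j x xs} → IsPartition (x ∷ xs) → x ≤ j → iterate L (x ∷ xs) j ≡ []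
iterate-L-beyond-head {zero}  ((() ∷ _) , _) z≤n
iterate-L-beyond-head {suc j} p x≤j =
  iterate-L-vanishes j (x≤j ∷ All.map (λ y≤x → ≤-trans y≤x x≤j) (head-dominates p))

iterate-L-nonempty : ∀ j {x xs} → j < x → iterate L (x ∷ xs) j ≢ []
iterate-L-nonempty zero    _ ()
iterate-L-nonempty (suc j) {suc (suc x)} (s≤s j<x) = iterate-L-nonempty j j<x

T∘L≡L∘T : ∀ {xs} → IsPartition xs → T (L xs) ≡ L (T xs)
T∘L≡L∘T {[]}                _ = refl
T∘L≡L∘T {zero ∷ xs}        ((() ∷ _) , _)
T∘L≡L∘T {suc zero ∷ xs}     p = trans (cong T L1≡[]) (sym L1≡[])
  where L1≡[] = L-vanishes (head-dominates p)
T∘L≡L∘T {suc (suc x) ∷ xs}  _ = refl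

T-iterate-L : ∀ j {xs} → IsPartition xs → T (iterate L xs j) ≡ iterate L (T xs) j
T-iterate-L zero    _ = refl
T-iterate-L (suc j) p = trans (T-iterate-L j (L-preserves-IsPartition p)) (cong (λ ys → iterate L ys j) (T∘L≡L∘T p))

subdiagrams : List ℕ → List (List ℕ)
subdiagrams []       = []
subdiagrams (x ∷ xs) = List.iterate L (x ∷ xs) x ++ subdiagrams xs

length-subdiagrams : ∀ xs → length (subdiagrams xs) ≡ ∣ xs ∣ₚ
length-subdiagrams []       = refl
length-subdiagrams (x ∷ xs) =
  trans (length-++ (List.iterate L (x ∷ xs) x)) (cong₂ _+_ (length-iterate L (x ∷ xs) x) (length-subdiagrams xs))

[]∉subdiagrams : ∀ xs → [] ∉ subdiagrams xs
[]∉subdiagrams (x ∷ xs) []∈ with ∈-++⁻ (List.iterate L (x ∷ xs) x) []∈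
... | inj₁ []∈row with j , j<x , []≡ ← ∈-iterate⁻ L (x ∷ xs) []∈row = iterate-L-nonempty j j<x (sym []≡)
... | inj₂ []∈rest = []∉subdiagrams xs []∈rest

length-L≤ : ∀ xs → length (L xs) ≤ length xs
length-L≤ xs = ≤-trans (length-filter (_>? 0) (map (λ x → x ∸ 1) xs)) (≤-reflexive (length-map (λ x → x ∸ 1) xs))

length-iterate-L≤ : ∀ j xs → length (iterate L xs j) ≤ length xs
length-iterate-L≤ zero    xs = ≤-refl
length-iterate-L≤ (suc j) xs = ≤-trans (length-iterate-L≤ j (L xs)) (length-L≤ xs)

length-subdiagram≤ : ∀ xs {ν} → ν ∈ subdiagrams xs → length ν ≤ length xs
length-subdiagram≤ (x ∷ xs) ν∈ with ∈-++⁻ (List.iterate L (x ∷ xs) x) ν∈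
... | inj₁ ν∈row with j , _ , refl ← ∈-iterate⁻ L (x ∷ xs) ν∈row = length-iterate-L≤ j (x ∷ xs)
... | inj₂ ν∈rest = m≤n⇒m≤1+n (length-subdiagram≤ xs ν∈rest)

iterate-L-singleton : ∀ j → iterate L [ suc j ] j ≡ [ 1 ]
iterate-L-singleton zero    = refl
iterate-L-singleton (suc j) = iterate-L-singleton j

iterate-L-strict-head : ∀ j {xs} → All (_≤ suc j) xs → iterate L (suc (suc j) ∷ xs) (suc j) ≡ [ 1 ]
iterate-L-strict-head zero    xs≤ = cong (1 ∷_) (L-vanishes xs≤)
iterate-L-strict-head (suc j) xs≤ = iterate-L-strict-head j (L-bounded xs≤)

[1]∈subdiagrams : ∀ x xs → All (_> 0) (x ∷ xs) → [ 1 ] ∈ subdiagrams (x ∷ xs)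
[1]∈subdiagrams (suc x) []       _ =
  ∈-++⁺ˡ (subst (_∈ List.iterate L [ suc x ] (suc x)) (iterate-L-singleton x) (∈-iterate⁺ L [ suc x ] (n<1+n x)))
[1]∈subdiagrams x       (y ∷ ys) (_ ∷ pos) = ∈-++⁺ʳ (List.iterate L (x ∷ y ∷ ys) x) ([1]∈subdiagrams y ys pos)

reach-◅ : ∀ {a b c} → Move a b → Star Move b c → Reach a c
reach-◅ a→b ε           = one a→b
reach-◅ a→b (b→ ◅ b→⋆c) = step a→b (reach-◅ b→ b→⋆c)

star-[] : ∀ xs → Star Move xs []
star-[] []       = ε
star-[] (x ∷ xs) = moveT x xs ◅ star-[] xs

star-iterate-L : ∀ j {x xs} → j < x → Star Move (x ∷ xs) (iterate L (x ∷ xs) j)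
star-iterate-L zero    _ = ε
star-iterate-L (suc j) {suc (suc x)} {xs} (s≤s j<x) = moveL (suc (suc x)) xs ◅ star-iterate-L j j<x

star-subdiagram : ∀ xs {ν} → ν ∈ subdiagrams xs → Star Move xs ν
star-subdiagram (x ∷ xs) ν∈ with ∈-++⁻ (List.iterate L (x ∷ xs) x) ν∈
... | inj₁ ν∈row with j , j<x , refl ← ∈-iterate⁻ L (x ∷ xs) ν∈row = star-iterate-L j j<x
... | inj₂ ν∈rest = moveT x xs ◅ star-subdiagram xs ν∈rest

cons-subdiagrams⁺ : ∀ {x xs μ} → μ ∈ [] ∷ subdiagrams xs → μ ∈ [] ∷ subdiagrams (x ∷ xs)
cons-subdiagrams⁺ (here μ≡[]) = here μ≡[]
cons-subdiagrams⁺ {x} {xs} (there μ∈) = there (∈-++⁺ʳ (List.iterate L (x ∷ xs) x) μ∈)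

iterate-L∈subdiagrams : ∀ j {xs} → IsPartition xs → iterate L xs j ∈ [] ∷ subdiagrams xs
iterate-L∈subdiagrams zero    {[]} _ = here refl
iterate-L∈subdiagrams (suc j) {[]} _ = here (iterate-L-vanishes j [])
iterate-L∈subdiagrams j {x ∷ xs} p with j <? x
... | yes j<x = there (∈-++⁺ˡ (∈-iterate⁺ L (x ∷ xs) j<x))
... | no  j≮x = here (iterate-L-beyond-head p (≮⇒≥ j≮x))

subdiagrams-closed : (f : List ℕ → List ℕ) →
  (∀ j {x xs} → IsPartition (x ∷ xs) → f (iterate L (x ∷ xs) j) ∈ [] ∷ subdiagrams (x ∷ xs)) →
  ∀ {xs ν} → IsPartition xs → ν ∈ subdiagrams xs → f ν ∈ [] ∷ subdiagrams xs
subdiagrams-closed f first-row {x ∷ xs} p ν∈ with ∈-++⁻ (List.iterate L (x ∷ xs) x) ν∈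
... | inj₁ ν∈row with j , _ , refl ← ∈-iterate⁻ L (x ∷ xs) ν∈row = first-row j p
... | inj₂ ν∈rest = cons-subdiagrams⁺ {x} (subdiagrams-closed f first-row (IsPartition-tail p) ν∈rest)

move-closed : ∀ {xs ν μ} → IsPartition xs → ν ∈ subdiagrams xs → Move ν μ → μ ∈ [] ∷ subdiagrams xs
move-closed p ν∈ (moveT _ _) = subdiagrams-closed T T-row p ν∈
  where
  T-row : ∀ j {x xs} → IsPartition (x ∷ xs) → T (iterate L (x ∷ xs) j) ∈ [] ∷ subdiagrams (x ∷ xs)
  T-row j {x} p =
    subst (_∈ _) (sym (T-iterate-L j p)) (cons-subdiagrams⁺ {x} (iterate-L∈subdiagrams j (IsPartition-tail p)))
move-closed p ν∈ (moveL _ _) = subdiagrams-closed L L-row p ν∈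
  where
  L-row : ∀ j {x xs} → IsPartition (x ∷ xs) → L (iterate L (x ∷ xs) j) ∈ [] ∷ subdiagrams (x ∷ xs)
  L-row j {x} {xs} p = subst (_∈ _) (iterate-sucʳ L (x ∷ xs) j) (iterate-L∈subdiagrams (suc j) p)

reach-closed : ∀ {xs ν μ} → IsPartition xs → ν ∈ [] ∷ subdiagrams xs → Reach ν μ → μ ∈ [] ∷ subdiagrams xs
reach-closed p (here refl) (one ())
reach-closed p (here refl) (step () _)
reach-closed p (there ν∈) (one ν→μ) = move-closed p ν∈ ν→μ
reach-closed p (there ν∈) (step ν→ →⁺μ) = reach-closed p (move-closed p ν∈ ν→) →⁺μ

size-L≤ : ∀ xs → ∣ L xs ∣ₚ ≤ ∣ xs ∣ₚ
size-L≤ []                 = z≤n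
size-L≤ (zero ∷ xs)        = size-L≤ xs
size-L≤ (suc zero ∷ xs)    = m≤n⇒m≤1+n (size-L≤ xs)
size-L≤ (suc (suc x) ∷ xs) = s≤s (+-mono-≤ (n≤1+n x) (size-L≤ xs))

move-shrinks : ∀ {a b} → All (_> 0) a → Move a b → ∣ b ∣ₚ < ∣ a ∣ₚ
move-shrinks (x>0 ∷ _) (moveT x xs)            = m<n+m (sum xs) x>0
move-shrinks (() ∷ _)  (moveL zero xs)
move-shrinks _         (moveL (suc zero) xs)    = s≤s (size-L≤ xs)
move-shrinks _         (moveL (suc (suc x)) xs) = s≤s (s≤s (+-monoʳ-≤ x (size-L≤ xs)))

move-positive : ∀ {a b} → All (_> 0) a → Move a b → All (_> 0) b
move-positive (_ ∷ pos) (moveT _ _)  = pos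
move-positive _         (moveL x xs) = all-filter (_>? 0) (map (λ y → y ∸ 1) (x ∷ xs))

reach-shrinks : ∀ {a b} → All (_> 0) a → Reach a b → ∣ b ∣ₚ < ∣ a ∣ₚ
reach-shrinks pos (one a→b)      = move-shrinks pos a→b
reach-shrinks pos (step a→ →⁺b) = <-trans (reach-shrinks (move-positive pos a→) →⁺b) (move-shrinks pos a→)

-- For a nonempty partition, drop 1 removes the subdiagram of the corner cell, λ itself.
reachables : List ℕ → List (List ℕ)
reachables xs = [] ∷ drop 1 (subdiagrams xs)

length-reachables : ∀ x xs → length (reachables (suc x ∷ xs)) ≡ ∣ suc x ∷ xs ∣ₚ
length-reachables x xs = cong suc (trans (length-++ (List.iterate L (L (suc x ∷ xs)) x))
  (cong₂ _+_ (length-iterate L (L (suc x ∷ xs)) x) (length-subdiagrams xs)))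

reachables-sound : ∀ {x xs μ} → μ ∈ reachables (suc x ∷ xs) → Reach (suc x ∷ xs) μ
reachables-sound {x} {xs} (here refl) = reach-◅ (moveT (suc x) xs) (star-[] xs)
reachables-sound {x} {xs} (there μ∈) with ∈-++⁻ (List.iterate L (L (suc x ∷ xs)) x) μ∈
reachables-sound {suc x} {xs} (there _) | inj₁ μ∈row =
  reach-◅ (moveL (suc (suc x)) xs) (star-subdiagram (L (suc (suc x) ∷ xs)) (∈-++⁺ˡ μ∈row))
... | inj₂ μ∈rest = reach-◅ (moveT (suc x) xs) (star-subdiagram xs μ∈rest)

reachables-complete : ∀ {x xs μ} → IsPartition (suc x ∷ xs) → Reach (suc x ∷ xs) μ →
  μ ∈ reachables (suc x ∷ xs)
reachables-complete p →⁺μ with reach-closed p (there (here refl)) →⁺μ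
... | here μ≡[]         = here μ≡[]
... | there (here refl) = ⊥-elim (<-irrefl refl (reach-shrinks (proj₁ p) →⁺μ))
... | there (there μ∈)  = there μ∈

reachables-enumerates : ∀ {x xs} → IsPartition (suc x ∷ xs) →
  ∀ μ → μ ∈ reachables (suc x ∷ xs) ⇔ Reach (suc x ∷ xs) μ
reachables-enumerates p μ = mk⇔ reachables-sound (reachables-complete p)

L-rect : ∀ k b → L (rect (suc (suc k)) b) ≡ rect (suc k) b
L-rect k zero    = refl
L-rect k (suc b) = cong (suc k ∷_) (L-rect k b)

first-row-rect : ∀ n b → List.iterate L (rect (suc n) b) (suc n) ≡ applyDownFrom (λ c → rect (suc c) b) (suc n)
first-row-rect zero    b = refl
first-row-rect (suc n) b =
  cong (rect (suc (suc n)) b ∷_) (trans (cong (λ r → List.iterate L r (suc n)) (L-rect n b)) (first-row-rect n b))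

subdiagrams-rect-unique : ∀ n b → Unique (subdiagrams (rect (suc n) b))
subdiagrams-rect-unique n zero    = []
subdiagrams-rect-unique n (suc b) =
  subst (λ row → Unique (row ++ subdiagrams (rect (suc n) b))) (sym (first-row-rect n (suc b)))
    (++⁺ (applyDownFrom⁺₁ (λ c → rect (suc c) (suc b)) (suc n) heads-differ) (subdiagrams-rect-unique n b) row-disjoint)
  where
  heads-differ : ∀ {i j} → j < i → i < suc n → rect (suc i) (suc b) ≢ rect (suc j) (suc b)
  heads-differ j<i _ rᵢ≡rⱼ = <⇒≢ j<i (sym (suc-injective (∷-injectiveˡ rᵢ≡rⱼ)))
  -- Rectangles in the first row have b + 1 parts, the later subdiagrams at most b.
  row-disjoint : Disjoint (applyDownFrom (λ c → rect (suc c) (suc b)) (suc n)) (subdiagrams (rect (suc n) b))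
  row-disjoint (μ∈row , μ∈rest) with c , _ , refl ← ∈-applyDownFrom⁻ (λ c → rect (suc c) (suc b)) μ∈row =
    1+n≰n (subst₂ _≤_ (length-replicate (suc b)) (length-replicate b) (length-subdiagram≤ (rect (suc n) b) μ∈rest))

reachables-rect-unique : ∀ n m → Unique (reachables (rect (suc n) (suc m)))
reachables-rect-unique n m =
  All.tabulate (λ μ∈ []≡μ → []∉subdiagrams R (subst (_∈ subdiagrams R) (sym []≡μ) (there {x = R} μ∈)))
  ∷ drop⁺ 1 (subdiagrams-rect-unique n (suc m))
  where R = rect (suc n) (suc m)

¬Unique-++ʳ : ∀ {A : Set} (xs : List A) {ys} → ¬ Unique ys → ¬ Unique (xs ++ ys)
¬Unique-++ʳ []       ¬u         = ¬u
¬Unique-++ʳ (x ∷ xs) ¬u (_ ∷ u) = ¬Unique-++ʳ xs ¬u u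

¬Unique-++ : ∀ {A : Set} {a : A} xs {ys} → a ∈ xs → a ∈ ys → ¬ Unique (xs ++ ys)
¬Unique-++ (x ∷ xs) (here refl) a∈ys (x∉ ∷ _) = All.lookup x∉ (∈-++⁺ʳ xs a∈ys) refl
¬Unique-++ (x ∷ xs) (there a∈xs) a∈ys (_ ∷ u) = ¬Unique-++ xs a∈xs a∈ys u

IsRectangle-cons : ∀ {x xs} → IsRectangle (x ∷ xs) → IsRectangle (x ∷ x ∷ xs)
IsRectangle-cons (n , suc m , x∷xs≡) = n , suc (suc m) , cong₂ _∷_ (∷-injectiveˡ x∷xs≡) x∷xs≡

subdiagrams-tail-not-unique : ∀ {x xs} → IsPartition (x ∷ xs) → ¬ IsRectangle (x ∷ xs) →
  ¬ Unique (drop 1 (subdiagrams (x ∷ xs)))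
subdiagrams-tail-not-unique {zero}  ((() ∷ _) , _)
subdiagrams-tail-not-unique {suc x} {[]} _ ¬rect = ⊥-elim (¬rect (suc x , 1 , refl))
subdiagrams-tail-not-unique {suc x} {z ∷ zs} p ¬rect with m≤n⇒m<n∨m≡n (All.head (head-dominates p))
... | inj₂ refl = ¬Unique-++ʳ (List.iterate L (L (suc x ∷ suc x ∷ zs)) x)
  λ { (_ ∷ u) → subdiagrams-tail-not-unique (IsPartition-tail p) (¬rect ∘ IsRectangle-cons) u }
subdiagrams-tail-not-unique {suc (suc x)} {z ∷ zs} p@(_ ∷ z>0 ∷ pos , _) _ | inj₁ (s≤s z≤1+x) =
  ¬Unique-++ first-row [1]∈first-row ([1]∈subdiagrams z zs (z>0 ∷ pos))
  where
  first-row = List.iterate L (L (suc (suc x) ∷ z ∷ zs)) (suc x)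
  tail≤ : All (_≤ suc x) (z ∷ zs)
  tail≤ = z≤1+x ∷ All.map (λ y≤z → ≤-trans y≤z z≤1+x) (head-dominates (IsPartition-tail p))
  [1]∈first-row : [ 1 ] ∈ first-row
  [1]∈first-row =
    subst (_∈ first-row) (iterate-L-strict-head x tail≤) (∈-iterate⁺ L (L (suc (suc x) ∷ z ∷ zs)) (n<1+n x))
subdiagrams-tail-not-unique {suc zero} (_ ∷ z>0 ∷ _ , _) _ | inj₁ (s≤s z≤0) =
  ⊥-elim (<-irrefl refl (≤-trans z>0 z≤0))

reachables-not-unique : ∀ {x xs} → IsPartition (suc x ∷ xs) → ¬ IsRectangle (suc x ∷ xs) →
  ¬ Unique (reachables (suc x ∷ xs))
reachables-not-unique p ¬rect (_ ∷ u) = subdiagrams-tail-not-unique p ¬rect u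

module _ {A : Set} (_≟ᴬ_ : DecidableEquality A) where

  length-deduplicate-< : ∀ {xs} → ¬ Unique xs → length (deduplicate _≟ᴬ_ xs) < length xs
  length-deduplicate-< {[]} ¬u = ⊥-elim (¬u [])
  length-deduplicate-< {x ∷ xs} ¬u with _∈?_ _≟ᴬ_ x xs
  ... | yes x∈xs = s≤s (≤-trans
    (filter-notAll (¬? ∘ (x ≟ᴬ_)) (deduplicate _≟ᴬ_ xs) (Any.map (λ x≡ x≢ → x≢ x≡) (∈-deduplicate⁺ _≟ᴬ_ x∈xs)))
    (length-deduplicate _≟ᴬ_ xs))
  ... | no  x∉xs = s≤s (≤-trans (s≤s (length-filter (¬? ∘ (x ≟ᴬ_)) (deduplicate _≟ᴬ_ xs)))
    (length-deduplicate-< λ u → ¬u (All.tabulate (λ y∈xs x≡y → x∉xs (subst (_∈ xs) (sym x≡y) y∈xs)) ∷ u)))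

_≟ₗ_ : DecidableEquality (List ℕ)
_≟ₗ_ = ≡-dec _≟_

numReachable-deduplicate : ∀ {λs xs} → (∀ μ → μ ∈ xs ⇔ Reach λs μ) →
  NumReachable λs (length (deduplicate _≟ₗ_ xs))
numReachable-deduplicate {xs = xs} enum =
  deduplicate _≟ₗ_ xs , deduplicate-! _≟ₗ_ xs ,
  (λ μ → mk⇔ (Equivalence.to (enum μ) ∘ ∈-deduplicate⁻ _≟ₗ_ xs)
              (∈-deduplicate⁺ _≟ₗ_ ∘ Equivalence.from (enum μ))) ,
  refl

sum-replicate : ∀ m a → ∣ replicate m a ∣ₚ ≡ m * a
sum-replicate zero    a = refl
sum-replicate (suc m) a = cong (a +_) (sum-replicate m a)

IsPartition-rect : ∀ n m → IsPartition (rect (suc n) m)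
IsPartition-rect n m = replicate⁺ m (s≤s z≤n) , sorted m
  where
  sorted : ∀ m → Linked _≥_ (replicate m (suc n))
  sorted zero          = Linked.[]
  sorted (suc zero)    = Linked.[-]
  sorted (suc (suc m)) = ≤-refl ∷ sorted (suc m)

lemma3p18 :
    ((n m : ℕ) → NumReachable (rect (suc n) (suc m)) (suc m * suc n))
    × ((N : ℕ) → (λs : List ℕ) → IsPartition λs → ∣ λs ∣ₚ ≡ N → ¬ IsRectangle λs →
        ∃ λ k → k < N × NumReachable λs k)
lemma3p18 = rectangles , non-rectangles
  where
  rectangles : (n m : ℕ) → NumReachable (rect (suc n) (suc m)) (suc m * suc n)
  rectangles n m =
    reachables (rect (suc n) (suc m)) , reachables-rect-unique n m ,
    reachables-enumerates (IsPartition-rect n (suc m)) ,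
    trans (length-reachables n (rect (suc n) m)) (sum-replicate (suc m) (suc n))

  non-rectangles : (N : ℕ) → (λs : List ℕ) → IsPartition λs → ∣ λs ∣ₚ ≡ N → ¬ IsRectangle λs →
    ∃ λ k → k < N × NumReachable λs k
  non-rectangles N []            _              _    ¬rect = ⊥-elim (¬rect (0 , 0 , refl))
  non-rectangles N (zero ∷ xs)  ((() ∷ _) , _) _    _
  non-rectangles _ (suc x ∷ xs) p              refl ¬rect =
    length (deduplicate _≟ₗ_ (reachables (suc x ∷ xs))) ,
    <-≤-trans (length-deduplicate-< _≟ₗ_ (reachables-not-unique p ¬rect)) (≤-reflexive (length-reachables x xs)) ,
    numReachable-deduplicate (reachables-enumerates p)
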